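{- Let $\ell\ge1$, let $s,t\in\mathcal{T}_{\mathsf{n}}$, and let $C$ be a context such that $C[s]\in\mathcal{T}_{\mathsf{n}}$. If $\mathcal{I}(s)>_\ell\mathcal{I}(t)$, then $\mathcal{I}(C[s])>_\ell\mathcal{I}(C[t])$.
   Context: $\mathcal{F}=\mathcal{D}\uplus\mathcal{C}$ (defined symbols, constructors) with a safe mapping assigning to each $n$-ary $f$ a set $\mathsf{safe}(f)\subseteq\{1,\dots,n\}$ of safe positions (others normal; constructors have all positions safe). Write $f(s_1,\dots,s_k;s_{k+1},\dots,s_{k+n})$ with normal arguments first (position order), then safe ones. $\mathcal{T}_{\mathsf{n}}$ is the least set of terms containing $\mathcal{T}(\mathcal{C},\mathcal{V})$ and containing $f(s_1,\dots,s_k;t_1,\dots,t_n)$ whenever all normal arguments $s_i\in\mathcal{T}(\mathcal{C},\mathcal{V})$ and all safe arguments $t_j\in\mathcal{T}_{\mathsf{n}}$. A context is a term with exactly one occurrence of a hole $\Box$; $C[t]$ replaces the hole by $t$. For each $f\in\mathcal{D}$ let $f_{\mathsf{n}}$ be a fresh symbol whose arity is the number of normal positions of $f$; $\mathcal{F}_{\mathsf{n}}=\{f_{\mathsf{n}}\mid f\in\mathcal{D}\}\cup\mathcal{C}$, where the $f_{\mathsf{n}}$ are defined symbols. A quasi-precedence $\succsim$ on $\mathcal{F}$ (preorder, well-founded strict part $\succ$, equivalence $\sim$, admissible: defined symbols above constructors) is extended to $\mathcal{F}_{\mathsf{n}}$ by $f_{\mathsf{n}}\sim g_{\mathsf{n}}$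 iff $f\sim g$, $f_{\mathsf{n}}\succ g_{\mathsf{n}}$ iff $f\succ g$, and $f_{\mathsf{n}}\succ c$ for constructors $c$. Lists: $\mathcal{T}^*$ denotes finite lists $[t_1\cdots t_n]$ of terms over $\mathcal{F}_{\mathsf{n}}$; a term is identified with the singleton list; $\mathbin{+\!\!+}$ is concatenation. The predicative interpretation $\mathcal{I}:\mathcal{T}_{\mathsf{n}}\to\mathcal{T}^*$ is $\mathcal{I}(t)=[\,]$ if $t\in\mathcal{T}(\mathcal{C},\mathcal{V})$, and otherwise $\mathcal{I}(f(t_1,\dots,t_k;t_{k+1},\dots,t_{k+n}))=[f_{\mathsf{n}}(t_1,\dots,t_k)]\mathbin{+\!\!+}\mathcal{I}(t_{k+1})\mathbin{+\!\!+}\cdots\mathbin{+\!\!+}\mathcal{I}(t_{k+n})$. Term equivalence: $s\approx t$ iff $s=t$ or $s=f(s_1,\dots,s_n)$, $t=g(t_1,\dots,t_n)$, $f\sim g$, $s_i\approx t_i$ for all $i$; $f(s_1,\dots,s_m)\rhd t$ iff $s_i\unrhd t$ for some $i$, ${\unrhd}={\rhd}\cup{\approx}$. For $k\ge1$, $>_k$ is the least relation on $\mathcal{T}^*$ with $a>_k b$ if: (1) $a=f(s_1,\dots,s_m)$ and $s_i\ge_k b$ for some $i$; (2) $a=f(s_1,\dots,s_m)$, $f$ defined, $b=[t_1\cdots t_n]$ with $n=0$ or $2\le n\le k$, $a>_k t_j$ for all $j$; (3) $a=f(s_1,\dots,s_m)$, $b=g(t_1,\dots,t_n)$, $n\le k$,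 $f$ defined, $f\succ g$, $a\rhd t_j$ for all $j$; (4) $a=[s_1\cdots s_m]$, $b=b_1\mathbin{+\!\!+}\cdots\mathbin{+\!\!+}b_m$, and for some $j$: $s_i\approx b_i$ ($i<j$), $s_j>_k b_j$, $s_i\ge_k b_i$ ($i>j$); (5) $a=f(s_1,\dots,s_m)$, $b=g(t_1,\dots,t_n)$, $n\le k$, $f,g$ defined, $f\sim g$, and for some $j\le\min(m,n)$: $s_i\approx t_i$ ($i<j$), $s_j\rhd t_j$, $a\rhd t_i$ ($i>j$). ${\ge_k}={>_k}\cup{\approx}$. -}

module Defs where

open import Data.Nat using (ℕ; zero; suc; _≤_)
open import Data.Bool using (Bool; true; false)
open import Data.Fin using (Fin)
open import Data.Vec using (Vec; []; _∷_; lookup; tabulate; toList; _[_]≔_)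
open import Data.List using (List; []; _∷_; _++_; length)
open import Data.List.Relation.Unary.All using (All)
open import Data.Product using (_×_)
open import Data.Sum using (_⊎_)
open import Data.Unit using (⊤)
open import Data.Empty using (⊥)
open import Relation.Nullary using (¬_)
open import Relation.Binary.PropositionalEquality using (_≡_)
open import Induction.WellFounded using (WellFounded)

data Tm (S : Set) (ar : S → ℕ) (V : Set) : Set where
  var : V → Tm S ar V
  app : (f : S) → Vec (Tm S ar V) (ar f) → Tm S ar V

-- Signature F = D ⊎ C with a safe mapping.
-- isDefined f ≡ true  : f ∈ D ;  isDefined f ≡ false : f ∈ C.
-- safe f i ≡ true     : position i of f is safe (characteristic function of safe(f)).

record Signature : Set₁ where
  field
    Sym       : Set
    arity     : Sym → ℕ
    isDefined : Sym → Bool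
    safe      : (f : Sym) → Fin (arity f) → Bool
    constructorsSafe : ∀ c → isDefined c ≡ false → ∀ i → safe c i ≡ true

record QuasiPrecedence (Sig : Signature) : Set₁ where
  open Signature Sig
  field
    _≿_      : Sym → Sym → Set
    ≿-refl   : ∀ f → f ≿ f
    ≿-trans  : ∀ {f g h} → f ≿ g → g ≿ h → f ≿ h
    ≻-wf     : WellFounded (λ g f → (f ≿ g) × ¬ (g ≿ f))
    admissible : ∀ f c → isDefined f ≡ true → isDefined c ≡ false →
                 (f ≿ c) × ¬ (c ≿ f)

module Interp (Sig : Signature) (V : Set) (P : QuasiPrecedence Sig) where
  open Signature Sig
  open QuasiPrecedence P

  _≻_ : Sym → Sym → Set
  f ≻ g = (f ≿ g) × ¬ (g ≿ f)

  _∼_ : Sym → Sym → Set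
  f ∼ g = (f ≿ g) × (g ≿ f)

  Term : Set
  Term = Tm Sym arity V

  countN : ∀ {n} → Vec Bool n → ℕ
  countN []           = zero
  countN (true  ∷ bs) = countN bs
  countN (false ∷ bs) = suc (countN bs)

  safeVec : (f : Sym) → Vec Bool (arity f)
  safeVec f = tabulate (safe f)

  mutual
    data IsCT : Term → Set where
      ct-var : ∀ x → IsCT (var x)
      ct-app : ∀ {c ss} → isDefined c ≡ false → AllCT ss → IsCT (app c ss)

    data AllCT : ∀ {n} → Vec Term n → Set where
      []  : AllCT []
      _∷_ : ∀ {n t} {ts : Vec Term n} → IsCT t → AllCT ts → AllCT (t ∷ ts)

  mutual
    data Tn : Term → Set where
      tn-ct  : ∀ {t} → IsCT t → Tn t
      tn-app : ∀ {f ss} → isDefined f ≡ true → ArgsOK (safeVec f) ss → Tn (app f ss)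

    data ArgsOK : ∀ {n} → Vec Bool n → Vec Term n → Set where
      []     : ArgsOK [] []
      normal : ∀ {n t} {bs : Vec Bool n} {ts} → IsCT t → ArgsOK bs ts → ArgsOK (false ∷ bs) (t ∷ ts)
      safeA  : ∀ {n t} {bs : Vec Bool n} {ts} → Tn t → ArgsOK bs ts → ArgsOK (true ∷ bs) (t ∷ ts)

  -- Contexts: exactly one hole.  ctx f ss i C denotes f(ss) with the
  -- i-th argument replaced by C (the i-th entry of ss is ignored).

  data Ctx : Set where
    □   : Ctx
    ctx : (f : Sym) → Vec Term (arity f) → Fin (arity f) → Ctx → Ctx

  _[_]ᶜ : Ctx → Term → Term
  □ [ t ]ᶜ            = t
  ctx f ss i C [ t ]ᶜ = app f (ss [ i ]≔ (C [ t ]ᶜ))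

  data SymN : Set where
    fn : (f : Sym) → isDefined f ≡ true  → SymN
    cn : (c : Sym) → isDefined c ≡ false → SymN

  arityN : SymN → ℕ
  arityN (fn f _) = countN (safeVec f)
  arityN (cn c _) = arity c

  IsDefN : SymN → Set
  IsDefN (fn _ _) = ⊤
  IsDefN (cn _ _) = ⊥

  _∼ₙ_ : SymN → SymN → Set
  fn f _ ∼ₙ fn g _ = f ∼ g
  fn f _ ∼ₙ cn c _ = ⊥
  cn c _ ∼ₙ fn g _ = ⊥
  cn c _ ∼ₙ cn d _ = c ∼ d

  _≻ₙ_ : SymN → SymN → Set
  fn f _ ≻ₙ fn g _ = f ≻ g
  fn f _ ≻ₙ cn c _ = ⊤
  cn c _ ≻ₙ fn g _ = ⊥
  cn c _ ≻ₙ cn d _ = c ≻ d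

  TermN : Set
  TermN = Tm SymN arityN V

  TList : Set
  TList = List TermN

  [_]ˡ : TermN → TList
  [ t ]ˡ = t ∷ []

  mutual
    toN : ∀ {t} → IsCT t → TermN
    toN (ct-var x)                 = var x
    toN (ct-app {c = c} e as)      = app (cn c e) (toNs as)

    toNs : ∀ {n} {ts : Vec Term n} → AllCT ts → Vec TermN n
    toNs []       = []
    toNs (p ∷ ps) = toN p ∷ toNs ps

  mutual
    I : (t : Term) → Tn t → TList
    I t (tn-ct _)                    = []
    I (app f ss) (tn-app d ok)       = app (fn f d) (normalArgs ok) ∷ safeArgs ok

    normalArgs : ∀ {n} {bs : Vec Bool n} {ts} → ArgsOK bs ts → Vec TermN (countN bs)
    normalArgs []             = []
    normalArgs (normal c ok)  = toN c ∷ normalArgs ok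
    normalArgs (safeA _ ok)   = normalArgs ok

    safeArgs : ∀ {n} {bs : Vec Bool n} {ts} → ArgsOK bs ts → TList
    safeArgs []               = []
    safeArgs (normal _ ok)    = safeArgs ok
    safeArgs (safeA {t = t} p ok) = I t p ++ safeArgs ok

  mutual
    data _≈_ : TermN → TermN → Set where
      ≈-refl : ∀ {s} → s ≈ s
      ≈-app  : ∀ {f g ss ts} → f ∼ₙ g → (toList ss) ≈ˡ (toList ts) → app f ss ≈ app g ts

    data _≈ˡ_ : TList → TList → Set where
      []  : [] ≈ˡ []
      _∷_ : ∀ {s t ss ts} → s ≈ t → ss ≈ˡ ts → (s ∷ ss) ≈ˡ (t ∷ ts)

  mutual
    data _⊳_ : TermN → TermN → Set where
      ⊳-arg : ∀ {f ss t} (i : Fin (arityN f)) → lookup ss i ⊵ t → app f ss ⊳ t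

    data _⊵_ : TermN → TermN → Set where
      ⊵-⊳ : ∀ {s t} → s ⊳ t → s ⊵ t
      ⊵-≈ : ∀ {s t} → s ≈ t → s ⊵ t

  data Lex5 (a : TermN) : TList → TList → Set where
    lex-≈    : ∀ {s t ss ts} → s ≈ t → Lex5 a ss ts → Lex5 a (s ∷ ss) (t ∷ ts)
    lex-here : ∀ {s t ss ts} → s ⊳ t → All (a ⊳_) ts → Lex5 a (s ∷ ss) (t ∷ ts)

  mutual
    data _>[_]_ : TList → ℕ → TList → Set where
      gt1 : ∀ {k f ss b} (i : Fin (arityN f)) →
            [ lookup ss i ]ˡ ≥[ k ] b → [ app f ss ]ˡ >[ k ] b
      gt2 : ∀ {k f ss b} → IsDefN f →
            (length b ≡ 0 ⊎ (2 ≤ length b × length b ≤ k)) →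
            All (λ t → [ app f ss ]ˡ >[ k ] [ t ]ˡ) b →
            [ app f ss ]ˡ >[ k ] b
      gt3 : ∀ {k f ss g ts} → arityN g ≤ k → IsDefN f → f ≻ₙ g →
            (∀ j → app f ss ⊳ lookup ts j) →
            [ app f ss ]ˡ >[ k ] [ app g ts ]ˡ
      gt4 : ∀ {k a b} → Lex4 k a b → a >[ k ] b
      gt5 : ∀ {k f ss g ts} → arityN g ≤ k → IsDefN f → IsDefN g → f ∼ₙ g →
            Lex5 (app f ss) (toList ss) (toList ts) →
            [ app f ss ]ˡ >[ k ] [ app g ts ]ˡ

    data _≥[_]_ : TList → ℕ → TList → Set where
      ≥-> : ∀ {k a b} → a >[ k ] b → a ≥[ k ] b
      ≥-≈ : ∀ {k a b} → a ≈ˡ b → a ≥[ k ] b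

    data Lex4 (k : ℕ) : TList → TList → Set where
      lex4-≈    : ∀ {s ss b b₁ b₂} → [ s ]ˡ ≈ˡ b₁ → Lex4 k ss b₂ → b ≡ b₁ ++ b₂ →
                  Lex4 k (s ∷ ss) b
      lex4-here : ∀ {s ss b b₁ b₂} → [ s ]ˡ >[ k ] b₁ → AllGe k ss b₂ → b ≡ b₁ ++ b₂ →
                  Lex4 k (s ∷ ss) b

    data AllGe (k : ℕ) : TList → TList → Set where
      []  : AllGe k [] []
      cons : ∀ {s ss b b₁ b₂} → [ s ]ˡ ≥[ k ] b₁ → AllGe k ss b₂ → b ≡ b₁ ++ b₂ →
             AllGe k (s ∷ ss) b

{-# OPTIONS --safe #-}
module Submission where

open import Defs
open import Data.Nat using (ℕ; _≤_)
open import Data.Product using (Σ; _,_; _×_; map; map₁; map₂)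
open import Data.Bool using (Bool; true; false; _≟_)
open import Data.Fin using (Fin; zero; suc)
open import Data.Vec using (Vec; []; _∷_; _[_]≔_)
open import Data.List using ([]; _∷_; _++_)
open import Data.List.Properties using (++-assoc; ++-identityʳ)
open import Data.Empty using (⊥; ⊥-elim)
open import Relation.Nullary using (¬_)
open import Relation.Binary.PropositionalEquality
open import Axiom.UniquenessOfIdentityProofs using (module Decidable⇒UIP)

-- If the hole of C lies below a normal argument, then s ∈ T(C,V), so
-- I(s) = [] is >ₖ-minimal and the hypothesis fails.  Otherwise the hole lies below safe
-- arguments only, and I(C[s]) = [h] ++ A ++ I(s) ++ B with h, A, B independent of s; clause (4)
-- of >ₖ is compatible with such a surrounding.  (I is proof irrelevant, since the proofs it
-- depends on are equalities in Bool.)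

Bool-irrelevant : {a b : Bool} (p q : a ≡ b) → p ≡ q
Bool-irrelevant = Decidable⇒UIP.≡-irrelevant _≟_

≡true-≡false-absurd : {b : Bool} → b ≡ true → b ≡ false → ⊥
≡true-≡false-absurd refl ()

module _ (Sig : Signature) (V : Set) (P : QuasiPrecedence Sig) where
  open Signature Sig
  open Interp Sig V P

  mutual
    toN-irrelevant : ∀ {t} (p q : IsCT t) → toN p ≡ toN q
    toN-irrelevant (ct-var x) (ct-var .x) = refl
    toN-irrelevant (ct-app {c = c} e as) (ct-app e′ as′) =
      cong₂ (λ e xs → app (cn c e) xs) (Bool-irrelevant e e′) (toNs-irrelevant as as′)

    toNs-irrelevant : ∀ {n} {ts : Vec Term n} (p q : AllCT ts) → toNs p ≡ toNs q
    toNs-irrelevant []       []       = refl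
    toNs-irrelevant (p ∷ ps) (q ∷ qs) = cong₂ _∷_ (toN-irrelevant p q) (toNs-irrelevant ps qs)

  mutual
    I-irrelevant : ∀ {t} (p q : Tn t) → I t p ≡ I t q
    I-irrelevant (tn-ct _)             (tn-ct _)             = refl
    I-irrelevant (tn-ct (ct-app e _))  (tn-app d _)          = ⊥-elim (≡true-≡false-absurd d e)
    I-irrelevant (tn-app d _)          (tn-ct (ct-app e _))  = ⊥-elim (≡true-≡false-absurd d e)
    I-irrelevant (tn-app {f = f} d ok) (tn-app d′ ok′) =
      cong₂ _∷_ (cong₂ (λ d xs → app (fn f d) xs) (Bool-irrelevant d d′) (normalArgs-irrelevant ok ok′))
                (safeArgs-irrelevant ok ok′)

    normalArgs-irrelevant : ∀ {n} {bs : Vec Bool n} {ts} (p q : ArgsOK bs ts) →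
                            normalArgs p ≡ normalArgs q
    normalArgs-irrelevant []           []            = refl
    normalArgs-irrelevant (normal c p) (normal c′ q) = cong₂ _∷_ (toN-irrelevant c c′) (normalArgs-irrelevant p q)
    normalArgs-irrelevant (safeA _ p)  (safeA _ q)   = normalArgs-irrelevant p q

    safeArgs-irrelevant : ∀ {n} {bs : Vec Bool n} {ts} (p q : ArgsOK bs ts) →
                          safeArgs p ≡ safeArgs q
    safeArgs-irrelevant []           []           = refl
    safeArgs-irrelevant (normal _ p) (normal _ q) = safeArgs-irrelevant p q
    safeArgs-irrelevant (safeA x p)  (safeA y q)  = cong₂ _++_ (I-irrelevant x y) (safeArgs-irrelevant p q)

  []-minimal : ∀ {k Y} → ¬ ([] >[ k ] Y)
  []-minimal (gt4 ())

  IsCT⇒I-minimal : ∀ {k s Y} → IsCT s → (ps : Tn s) → ¬ (I s ps >[ k ] Y)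
  IsCT⇒I-minimal _            (tn-ct _)    = []-minimal
  IsCT⇒I-minimal (ct-app e _) (tn-app d _) = λ _ → ≡true-≡false-absurd d e

  AllCT-≔⁻ : ∀ {n} (ts : Vec Term n) i u → AllCT (ts [ i ]≔ u) → IsCT u
  AllCT-≔⁻ (_ ∷ _)  zero    u (p ∷ _)  = p
  AllCT-≔⁻ (_ ∷ ts) (suc i) u (_ ∷ ps) = AllCT-≔⁻ ts i u ps

  IsCT-plug⁻ : ∀ C s → IsCT (C [ s ]ᶜ) → IsCT s
  IsCT-plug⁻ □              s p             = p
  IsCT-plug⁻ (ctx f ss i C) s (ct-app _ as) = IsCT-plug⁻ C s (AllCT-≔⁻ ss i (C [ s ]ᶜ) as)

  >⇒Lex4 : ∀ {k X Y} → X >[ k ] Y → Lex4 k X Y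
  >⇒Lex4 (gt4 l) = l
  >⇒Lex4 {Y = Y} g@(gt1 _ _)       = lex4-here g [] (sym (++-identityʳ Y))
  >⇒Lex4 {Y = Y} g@(gt2 _ _ _)     = lex4-here g [] (sym (++-identityʳ Y))
  >⇒Lex4 {Y = Y} g@(gt3 _ _ _ _)   = lex4-here g [] (sym (++-identityʳ Y))
  >⇒Lex4 {Y = Y} g@(gt5 _ _ _ _ _) = lex4-here g [] (sym (++-identityʳ Y))

  AllGe-refl : ∀ {k} X → AllGe k X X
  AllGe-refl []      = []
  AllGe-refl (_ ∷ X) = cons (≥-≈ (≈-refl ∷ [])) (AllGe-refl X) refl

  AllGe-++ʳ : ∀ {k X Y} Z → AllGe k X Y → AllGe k (X ++ Z) (Y ++ Z)
  AllGe-++ʳ Z []                                 = AllGe-refl Z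
  AllGe-++ʳ Z (cons {b₁ = Y₁} {b₂ = Y₂} g r refl) = cons g (AllGe-++ʳ Z r) (++-assoc Y₁ Y₂ Z)

  Lex4-++ʳ : ∀ {k X Y} Z → Lex4 k X Y → Lex4 k (X ++ Z) (Y ++ Z)
  Lex4-++ʳ Z (lex4-≈ {b₁ = Y₁} {b₂ = Y₂} e l refl)    = lex4-≈ e (Lex4-++ʳ Z l) (++-assoc Y₁ Y₂ Z)
  Lex4-++ʳ Z (lex4-here {b₁ = Y₁} {b₂ = Y₂} g r refl) = lex4-here g (AllGe-++ʳ Z r) (++-assoc Y₁ Y₂ Z)

  Lex4-++ˡ : ∀ {k X Y} Z → Lex4 k X Y → Lex4 k (Z ++ X) (Z ++ Y)
  Lex4-++ˡ []      l = l
  Lex4-++ˡ (_ ∷ Z) l = lex4-≈ (≈-refl ∷ []) (Lex4-++ˡ Z l) refl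

  >-++-mono : ∀ {k X Y} A B → X >[ k ] Y → (A ++ X ++ B) >[ k ] (A ++ Y ++ B)
  >-++-mono A B X>Y = gt4 (Lex4-++ˡ A (Lex4-++ʳ B (>⇒Lex4 X>Y)))

  Refill : ∀ {n} {bs : Vec Bool n} (ts : Vec Term n) i {u} → ArgsOK bs (ts [ i ]≔ u) →
           (A B : TList) (u′ : Term) → Tn u′ → Set
  Refill {bs = bs} ts i ok A B u′ pu′ =
    Σ (ArgsOK bs (ts [ i ]≔ u′)) λ ok′ →
      normalArgs ok′ ≡ normalArgs ok × safeArgs ok′ ≡ A ++ I u′ pu′ ++ B

  data HolePosition {n} (bs : Vec Bool n) (ts : Vec Term n) (i : Fin n) (u : Term)
                    (ok : ArgsOK bs (ts [ i ]≔ u)) : Set where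
    normalHole : IsCT u → HolePosition bs ts i u ok
    safeHole   : (pu : Tn u) (A B : TList) → safeArgs ok ≡ A ++ I u pu ++ B →
                 (∀ u′ (pu′ : Tn u′) → Refill ts i ok A B u′ pu′) →
                 HolePosition bs ts i u ok

  holePosition : ∀ {n} (bs : Vec Bool n) (ts : Vec Term n) i u (ok : ArgsOK bs (ts [ i ]≔ u)) →
                 HolePosition bs ts i u ok
  holePosition (_ ∷ _) (_ ∷ _) zero u (normal c _) = normalHole c
  holePosition (_ ∷ _) (_ ∷ _) zero u (safeA pu ok) =
    safeHole pu [] (safeArgs ok) refl (λ _ pu′ → safeA pu′ ok , refl , refl)
  holePosition (_ ∷ bs) (_ ∷ ts) (suc i) u (normal c ok) with holePosition bs ts i u ok
  ... | normalHole cu              = normalHole cu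
  ... | safeHole pu A B eq refill =
    safeHole pu A B eq (λ u′ pu′ → map (normal c) (map₁ (cong (toN c ∷_))) (refill u′ pu′))
  holePosition (_ ∷ bs) (x ∷ ts) (suc i) u (safeA px ok) with holePosition bs ts i u ok
  ... | normalHole cu              = normalHole cu
  ... | safeHole pu A B eq refill =
    safeHole pu (I x px ++ A) B (shift eq) (λ u′ pu′ → map (safeA px) (map₂ shift) (refill u′ pu′))
    where
      shift : ∀ {Z W} → Z ≡ A ++ W → I x px ++ Z ≡ (I x px ++ A) ++ W
      shift {W = W} refl = sym (++-assoc (I x px) A W)

  >-plug : ∀ {ℓ} C {s t} (ps : Tn s) (pt : Tn t) (pCs : Tn (C [ s ]ᶜ)) → I s ps >[ ℓ ] I t pt →
           Σ (Tn (C [ t ]ᶜ)) λ pCt → I (C [ s ]ᶜ) pCs >[ ℓ ] I (C [ t ]ᶜ) pCt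
  >-plug □ ps pt pCs s>t = pt , subst (_>[ _ ] _) (I-irrelevant ps pCs) s>t
  >-plug C@(ctx _ _ _ _) {s} ps pt (tn-ct Cs∈CT) s>t =
    ⊥-elim (IsCT⇒I-minimal (IsCT-plug⁻ C s Cs∈CT) ps s>t)
  >-plug {ℓ} (ctx f ss i C) {s} {t} ps pt (tn-app d ok) s>t with holePosition (safeVec f) ss i (C [ s ]ᶜ) ok
  ... | normalHole Cs∈CT = ⊥-elim (IsCT⇒I-minimal (IsCT-plug⁻ C s Cs∈CT) ps s>t)
  ... | safeHole pCs A B ok≡ refill with >-plug C ps pt pCs s>t
  ... | pCt , Cs>Ct with refill (C [ t ]ᶜ) pCt
  ... | ok′ , normal≡ , safe≡ =
    tn-app d ok′ ,
    subst₂ _>[ ℓ ]_ (cong (h ∷_) (sym ok≡))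
                    (cong₂ (λ N Z → app (fn f d) N ∷ Z) (sym normal≡) (sym safe≡))
                    (>-++-mono (h ∷ A) B Cs>Ct)
    where h = app (fn f d) (normalArgs ok)

lemma6 : (Sig : Signature) (V : Set) (P : QuasiPrecedence Sig) →
    let open Interp Sig V P in
    (ℓ : ℕ) → 1 ≤ ℓ →
    (s t : Term) (ps : Tn s) (pt : Tn t) (C : Ctx) (pCs : Tn (C [ s ]ᶜ)) →
    I s ps >[ ℓ ] I t pt →
    Σ (Tn (C [ t ]ᶜ)) (λ pCt → I (C [ s ]ᶜ) pCs >[ ℓ ] I (C [ t ]ᶜ) pCt)
lemma6 Sig V P ℓ _ s t ps pt C pCs = >-plug Sig V P C ps pt pCs
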